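{- Let $\varphi$ be a $\mathbb{BST}$-conjunction and $\psi$ a conjunction of atoms of the form $x=\{y\}$. If $\varphi\wedge\Xi^\psi_\varphi$ is satisfiable, then $\varphi\wedge\psi$ is satisfiable.
   Context: Set variables range over the von Neumann universe of well-founded sets; a set assignment maps variables to well-founded sets, and a formula is satisfiable if some set assignment satisfies it. A $\mathbb{BST}$-conjunction is a conjunction of literals of the forms $u=v\setminus w$ and $u\neq v\setminus w$. $\mathrm{Vars}(\varphi\wedge\psi)$ is the set of variables occurring in $\varphi\wedge\psi$; for each $v$ in it a new distinct auxiliary variable $\tilde v$ is introduced. $\Xi^\psi_\varphi$ is the conjunction of: (i) $x\not\subseteq y$ for each conjunct $x=\{y\}$ of $\psi$; (ii) $(y=y'\leftrightarrow x=x')$ for each pair of conjuncts $x=\{y\}$, $x'=\{y'\}$ of $\psi$; (iii) $(x\cap v\neq\emptyset\to x\subseteq v)$ for each conjunct $x=\{y\}$ of $\psi$ and each $v\in\mathrm{Vars}(\varphi\wedge\psi)$; (iv) $(x\cap v\neq\emptyset\to\tilde y\subsetneq\tilde v)$ for each conjunct $x=\{y\}$ of $\psi$ and $v\in\mathrm{Vars}(\varphi\wedge\psi)$; (v) $(x=y\to\tilde x=\tilde y)$ for all $x,y\in\mathrm{Vars}(\varphi\wedge\psi)$. -}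

module Defs where

open import Level using (Level; 0ℓ) renaming (suc to lsuc)
open import Data.Nat using (ℕ)
open import Data.Product using (Σ; _×_; _,_; ∃)
open import Data.List using (List; []; _∷_; _++_)
open import Data.List.Relation.Unary.All using (All)
open import Data.List.Membership.Propositional using (_∈_)
open import Relation.Nullary using (¬_)
open import Function.Bundles using (_⇔_)

-- Well-founded sets: Aczel's iterative sets (W-type), with extensional
-- equality _≐_ (bisimulation) and membership _∈ᵥ_.

data V : Set₁ where
  sup : (A : Set) → (A → V) → V

_≐_ : V → V → Set
sup A f ≐ sup B g =
  ((a : A) → Σ B λ b → f a ≐ g b) × ((b : B) → Σ A λ a → f a ≐ g b)

infix 4 _≐_ _∈ᵥ_ _⊆ᵥ_ _⊊ᵥ_

_∈ᵥ_ : V → V → Set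
x ∈ᵥ sup A f = Σ A λ a → x ≐ f a

_⊆ᵥ_ : V → V → Set₁
x ⊆ᵥ y = (z : V) → z ∈ᵥ x → z ∈ᵥ y

_⊊ᵥ_ : V → V → Set₁
x ⊊ᵥ y = x ⊆ᵥ y × ¬ (x ≐ y)

IsDiff : V → V → V → Set₁
IsDiff u v w = (z : V) → (z ∈ᵥ u) ⇔ (z ∈ᵥ v × ¬ (z ∈ᵥ w))

IsSingleton : V → V → Set₁
IsSingleton x y = (z : V) → (z ∈ᵥ x) ⇔ (z ≐ y)

InterNonEmpty : V → V → Set₁
InterNonEmpty x v = Σ V λ z → z ∈ᵥ x × z ∈ᵥ v

Var : Set
Var = ℕ

data Lit : Set where
  diff  : Var → Var → Var → Lit
  ndiff : Var → Var → Var → Lit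

BSTConj : Set
BSTConj = List Lit

SingConj : Set
SingConj = List (Var × Var)

Assignment : Set₁
Assignment = Var → V

SatLit : Assignment → Lit → Set₁
SatLit M (diff u v w)  = IsDiff (M u) (M v) (M w)
SatLit M (ndiff u v w) = ¬ IsDiff (M u) (M v) (M w)

SatBST : Assignment → BSTConj → Set₁
SatBST M φ = All (SatLit M) φ

SatSing : Assignment → SingConj → Set₁
SatSing M ψ = All (λ p → IsSingleton (M (Data.Product.proj₁ p)) (M (Data.Product.proj₂ p))) ψ

litVars : Lit → List Var
litVars (diff u v w)  = u ∷ v ∷ w ∷ []
litVars (ndiff u v w) = u ∷ v ∷ w ∷ []

bstVars : BSTConj → List Var
bstVars [] = []
bstVars (l ∷ φ) = litVars l ++ bstVars φ

singVars : SingConj → List Var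
singVars [] = []
singVars ((x , y) ∷ ψ) = x ∷ y ∷ singVars ψ

Vars : BSTConj → SingConj → List Var
Vars φ ψ = bstVars φ ++ singVars ψ

-- Satisfaction of Ξ^ψ_φ.  M interprets the original variables and
-- M~ interprets the fresh, pairwise distinct auxiliary variables ṽ
-- (ṽ is interpreted as M~ v).
SatXi : BSTConj → SingConj → Assignment → Assignment → Set₁
SatXi φ ψ M M~ =
  -- (i)
  (∀ {x y} → (x , y) ∈ ψ → ¬ (M x ⊆ᵥ M y)) ×
  -- (ii)
  (∀ {x y x' y'} → (x , y) ∈ ψ → (x' , y') ∈ ψ →
     (M y ≐ M y') ⇔ (M x ≐ M x')) ×
  -- (iii)
  (∀ {x y v} → (x , y) ∈ ψ → v ∈ Vars φ ψ →
     InterNonEmpty (M x) (M v) → M x ⊆ᵥ M v) ×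
  -- (iv)
  (∀ {x y v} → (x , y) ∈ ψ → v ∈ Vars φ ψ →
     InterNonEmpty (M x) (M v) → M~ y ⊊ᵥ M~ v) ×
  -- (v)
  (∀ {x y} → x ∈ Vars φ ψ → y ∈ Vars φ ψ →
     M x ≐ M y → M~ x ≐ M~ y)

SatisfiableWithXi : BSTConj → SingConj → Set₁
SatisfiableWithXi φ ψ =
  Σ Assignment λ M → Σ Assignment λ M~ → SatBST M φ × SatXi φ ψ M M~

Satisfiable : BSTConj → SingConj → Set₁
Satisfiable φ ψ = Σ Assignment λ M → SatBST M φ × SatSing M ψ

-- Rebuild the model by recursion: a member z of M t lying in some M (X i) is
-- replaced by the new value of Y i, every other member by a tag of z,
--   M′ t = {tag z | z ∈ M t uncovered} ∪ {M′ (Y i) | M (X i) ∩ M t ≠ ∅}.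
-- By (iii) each M (X i) lies inside every M t it meets, so z ∈ M t holds iff
-- its representative lies in M′ t, and the Boolean literals of φ transfer.
-- By (i) each M (X i) is inhabited, and then (ii) and (iii) give
-- M′ (X i) = {M′ (Y i)}. The recursion terminates because by (iv) the number
-- of variables whose M̃-value lies strictly below that of t drops from t to
-- Y i; it is run as a stage-indexed iteration that is stable after |Vars|
-- steps. A tag contains more numerals than there are atoms, so by pigeonhole
-- it is never a value of a stage; with (ii) this makes stage n injective, up
-- to ≐, on the M-values of variables of rank below n.
module Submission where

open import Defs
open import Level using (0ℓ; Lift; lift; lower) renaming (suc to lsuc)
open import Axiom.ExcludedMiddle using (ExcludedMiddle)
open import Data.Nat using (ℕ; zero; suc; pred; _<_; _≤_; s≤s⁻¹)
open import Data.Nat.Properties using (<-≤-trans; ≤∧≢⇒<; <-irrefl; n<1+n; m<n⇒m<1+n)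
open import Data.Fin using (Fin; toℕ) renaming (zero to fzero; _<_ to _<ᶠ_)
open import Data.Fin.Properties using (pigeonhole)
open import Data.Bool using (Bool; true; false)
open import Data.Unit using (⊤; tt)
open import Data.Empty using (⊥; ⊥-elim)
open import Data.Sum using (_⊎_; inj₁; inj₂; [_,_])
open import Data.Product using (Σ; _×_; _,_; proj₁; proj₂; map₂)
open import Data.Product.Function.NonDependent.Propositional using (_×-⇔_)
open import Data.List using (List; []; _∷_; length; lookup; filter)
open import Data.List.Properties using (length-filter; tabulate-lookup)
open import Data.List.Relation.Unary.All using (All; []; _∷_)
open import Data.List.Relation.Unary.All.Properties using (tabulate⁺)
open import Data.List.Relation.Unary.Any using (here; there)
open import Data.List.Membership.Propositional using (_∈_)
open import Data.List.Membership.Propositional.Properties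
  using (∈-lookup; ∈-++⁺ˡ; ∈-++⁺ʳ; ∈-filter⁺; ∈-filter⁻)
open import Data.List.Relation.Binary.Sublist.Propositional using (_⊆_; ⊆-refl)
open import Data.List.Relation.Binary.Sublist.Propositional.Properties
  using (filter⁺; length-mono-≤; to-≋)
open import Data.List.Relation.Binary.Equality.Propositional using (≋⇒≡)
open import Relation.Nullary using (¬_; Dec; yes; no)
open import Relation.Nullary.Decidable using (map′)
open import Relation.Unary using (Pred; Decidable) renaming (_⊆_ to _⇒_)
open import Relation.Binary.Definitions using (Reflexive; Symmetric; Transitive)
open import Relation.Binary.PropositionalEquality using (_≡_; refl; sym; subst; cong)
open import Function.Base using (_∘_; const)
open import Function.Bundles using (_⇔_; mk⇔; Equivalence)
open import Function.Construct.Composition using (_⇔-∘_)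
open import Function.Construct.Symmetry using (⇔-sym)
open import Function.Related.TypeIsomorphisms using (¬-cong-⇔)

open Equivalence using (to; from)

≐-refl : Reflexive _≐_
≐-refl {sup A f} = (λ a → a , ≐-refl) , (λ a → a , ≐-refl)

≐-sym : Symmetric _≐_
≐-sym {sup A f} {sup B g} (f⊆g , g⊆f) =
  (λ b → map₂ ≐-sym (g⊆f b)) , (λ a → map₂ ≐-sym (f⊆g a))

≐-trans : Transitive _≐_
≐-trans {sup A f} {sup B g} {sup C h} (f⊆g , g⊆f) (g⊆h , h⊆g) =
  (λ a → let b , fa≐gb = f⊆g a ; c , gb≐hc = g⊆h b in c , ≐-trans fa≐gb gb≐hc) ,
  (λ c → let b , gb≐hc = h⊆g c ; a , fa≐gb = g⊆f b in a , ≐-trans fa≐gb gb≐hc)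

∈ᵥ-resp-≐ : ∀ {z z′ s} → z ≐ z′ → z ∈ᵥ s → z′ ∈ᵥ s
∈ᵥ-resp-≐ {s = sup _ _} z≐z′ (a , z≐fa) = a , ≐-trans (≐-sym z≐z′) z≐fa

≐⇒⊆ᵥ : ∀ {s t} → s ≐ t → s ⊆ᵥ t
≐⇒⊆ᵥ {sup A f} {sup B g} (f⊆g , _) z (a , z≐fa) =
  let b , fa≐gb = f⊆g a in b , ≐-trans z≐fa fa≐gb

⊆ᵥ-antisym : ∀ {s t} → s ⊆ᵥ t → t ⊆ᵥ s → s ≐ t
⊆ᵥ-antisym {sup A f} {sup B g} s⊆t t⊆s =
  (λ a → s⊆t (f a) (a , ≐-refl)) ,
  (λ b → map₂ ≐-sym (t⊆s (g b) (b , ≐-refl)))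

⊊ᵥ-trans : ∀ {s t u} → s ⊊ᵥ t → t ⊊ᵥ u → s ⊊ᵥ u
⊊ᵥ-trans (s⊆t , s≉t) (t⊆u , _) =
  (λ z → t⊆u z ∘ s⊆t z) ,
  λ s≐u → s≉t (⊆ᵥ-antisym s⊆t (λ z → ≐⇒⊆ᵥ (≐-sym s≐u) z ∘ t⊆u z))

⊊ᵥ-irrefl : ∀ {s} → ¬ (s ⊊ᵥ s)
⊊ᵥ-irrefl (_ , s≉s) = s≉s ≐-refl

index : V → Set
index (sup A _) = A

member : (s : V) → index s → V
member (sup _ f) a = f a

member-∈ᵥ : ∀ s a → member s a ∈ᵥ s
member-∈ᵥ (sup _ _) a = a , ≐-refl

∈ᵥ⇒member : ∀ {z s} → z ∈ᵥ s → Σ (index s) λ a → z ≐ member s a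
∈ᵥ⇒member {s = sup _ _} z∈s = z∈s

sup-cong : ∀ {A : Set} {f g : A → V} → (∀ a → f a ≐ g a) → sup A f ≐ sup A g
sup-cong f≐g = (λ a → a , f≐g a) , (λ a → a , f≐g a)

∅ᵥ : V
∅ᵥ = sup ⊥ λ ()

singleton : V → V
singleton a = sup ⊤ (const a)

pair : V → V → V
pair a b = sup Bool λ { true → a ; false → b }

singleton≉∅ᵥ : ∀ {a} → ¬ (singleton a ≐ ∅ᵥ)
singleton≉∅ᵥ (a⊆∅ , _) = proj₁ (a⊆∅ tt)

singleton-injective : ∀ {a b} → singleton a ≐ singleton b → a ≐ b
singleton-injective (a⊆b , _) = proj₂ (a⊆b tt)

numeral : ℕ → V
numeral zero    = ∅ᵥ
numeral (suc n) = singleton (numeral n)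

numeral-injective : ∀ m n → numeral m ≐ numeral n → m ≡ n
numeral-injective zero    zero    _  = refl
numeral-injective zero    (suc n) eq = ⊥-elim (singleton≉∅ᵥ (≐-sym eq))
numeral-injective (suc m) zero    eq = ⊥-elim (singleton≉∅ᵥ eq)
numeral-injective (suc m) (suc n) eq =
  cong suc (numeral-injective m n (singleton-injective eq))

label : V → V
label z = pair ∅ᵥ (singleton z)

label-cong : ∀ {z z′} → z ≐ z′ → label z ≐ label z′
label-cong z≐z′ = sup-cong λ { true → ≐-refl ; false → sup-cong (const z≐z′) }

label-injective : ∀ {z z′} → label z ≐ label z′ → z ≐ z′
label-injective (z⊆z′ , _) with z⊆z′ false
... | true  , eq = ⊥-elim (singleton≉∅ᵥ eq)
... | false , eq = singleton-injective eq

label≉numeral : ∀ z n → ¬ (label z ≐ numeral n)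
label≉numeral z zero    (l⊆n , _) = proj₁ (l⊆n true)
label≉numeral z (suc n) (l⊆n , _) =
  singleton≉∅ᵥ (≐-trans (proj₂ (l⊆n false)) (≐-sym (proj₂ (l⊆n true))))

tag : ℕ → V → V
tag w z = sup (Fin (suc w) ⊎ ⊤) [ numeral ∘ toℕ , const (label z) ]

tag-cong : ∀ {w z z′} → z ≐ z′ → tag w z ≐ tag w z′
tag-cong z≐z′ = sup-cong λ { (inj₁ _) → ≐-refl ; (inj₂ _) → label-cong z≐z′ }

tag-injective : ∀ {w z z′} → tag w z ≐ tag w z′ → z ≐ z′
tag-injective (z⊆z′ , _) with z⊆z′ (inj₂ tt)
... | inj₁ i , eq = ⊥-elim (label≉numeral _ (toℕ i) eq)
... | inj₂ _ , eq = label-injective eq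

numeral≉tag : ∀ n {w z} → ¬ (numeral n ≐ tag w z)
numeral≉tag zero    (_ , t⊆n) = proj₁ (t⊆n (inj₂ tt))
numeral≉tag (suc n) (_ , t⊆n) =
  label≉numeral _ 0 (≐-trans (≐-sym (proj₂ (t⊆n (inj₂ tt)))) (proj₂ (t⊆n (inj₁ fzero))))

tag≉narrow : ∀ {w z s} (f : Fin w → V) →
             (∀ {e} → e ∈ᵥ s → (Σ V λ z′ → e ≐ tag w z′) ⊎ (Σ (Fin w) λ k → e ≐ f k)) →
             ¬ (tag w z ≐ s)
tag≉narrow {w} f narrow tag≐s = collision (pigeonhole (n<1+n w) (proj₁ ∘ numeral-value))
  where
  numeral-value : (i : Fin (suc w)) → Σ (Fin w) λ k → numeral (toℕ i) ≐ f k
  numeral-value i with narrow (≐⇒⊆ᵥ tag≐s _ (inj₁ i , ≐-refl))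
  ... | inj₁ (_ , eq) = ⊥-elim (numeral≉tag (toℕ i) eq)
  ... | inj₂ value    = value

  collision : ¬ (Σ (Fin (suc w)) λ i → Σ (Fin (suc w)) λ j →
                   i <ᶠ j × proj₁ (numeral-value i) ≡ proj₁ (numeral-value j))
  collision (i , j , i<j , same) = <-irrefl (numeral-injective (toℕ i) (toℕ j) i≐j) i<j
    where
    i≐j : numeral (toℕ i) ≐ numeral (toℕ j)
    i≐j = ≐-trans (subst (λ k → numeral (toℕ i) ≐ f k) same (proj₂ (numeral-value i)))
                  (≐-sym (proj₂ (numeral-value j)))

⇔-transport : ∀ {A A′ B B′ : Set} → A ⇔ A′ → B ⇔ B′ → A ⇔ B → A′ ⇔ B′
⇔-transport A⇔A′ B⇔B′ A⇔B = B⇔B′ ⇔-∘ (A⇔B ⇔-∘ ⇔-sym A⇔A′)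

module _ (R : V → V → Set) where

  record Tracks (s s′ : V) : Set₁ where
    field
      ∈-preserved : ∀ {z e} → R z e → z ∈ᵥ s ⇔ e ∈ᵥ s′
      ∈-covered   : ∀ {e} → e ∈ᵥ s′ → Σ V λ z → R z e

  open Tracks

  module _ {u v w u′ v′ w′ : V} (tu : Tracks u u′) (tv : Tracks v v′) (tw : Tracks w w′) where

    private
      diff-at : ∀ {z e} → R z e →
                (z ∈ᵥ u ⇔ (z ∈ᵥ v × ¬ z ∈ᵥ w)) ⇔ (e ∈ᵥ u′ ⇔ (e ∈ᵥ v′ × ¬ e ∈ᵥ w′))
      diff-at {z} {e} r = mk⇔ (⇔-transport (∈-preserved tu r) v∖w)
                              (⇔-transport (⇔-sym (∈-preserved tu r)) (⇔-sym v∖w))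
        where
        v∖w : (z ∈ᵥ v × ¬ z ∈ᵥ w) ⇔ (e ∈ᵥ v′ × ¬ e ∈ᵥ w′)
        v∖w = ∈-preserved tv r ×-⇔ ¬-cong-⇔ (∈-preserved tw r)

    IsDiff-preserved : IsDiff u v w → IsDiff u′ v′ w′
    IsDiff-preserved D e = mk⇔
      (λ e∈u′ → let z , r = ∈-covered tu e∈u′ in to (to (diff-at r) (D z)) e∈u′)
      (λ e∈v′∖w′ → let z , r = ∈-covered tv (proj₁ e∈v′∖w′) in
                   from (to (diff-at r) (D z)) e∈v′∖w′)

    IsDiff-reflected : (∀ z → Σ V (R z)) → IsDiff u′ v′ w′ → IsDiff u v w
    IsDiff-reflected represent D′ z = let e , r = represent z in from (diff-at r) (D′ e)

  module _ {M M′ : Assignment} (represent : ∀ z → Σ V (R z)) where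

    SatLit-preserved : ∀ l → (∀ {v} → v ∈ litVars l → Tracks (M v) (M′ v)) →
                       SatLit M l → SatLit M′ l
    SatLit-preserved (diff u v w) tracks =
      IsDiff-preserved (tracks (here refl)) (tracks (there (here refl)))
                       (tracks (there (there (here refl))))
    SatLit-preserved (ndiff u v w) tracks ¬D D′ =
      ¬D (IsDiff-reflected (tracks (here refl)) (tracks (there (here refl)))
                           (tracks (there (there (here refl)))) represent D′)

    SatBST-preserved : ∀ φ → (∀ {v} → v ∈ bstVars φ → Tracks (M v) (M′ v)) →
                       SatBST M φ → SatBST M′ φ
    SatBST-preserved []      _      []       = []
    SatBST-preserved (l ∷ φ) tracks (p ∷ ps) =
      SatLit-preserved l (tracks ∘ ∈-++⁺ˡ) p ∷
      SatBST-preserved φ (tracks ∘ ∈-++⁺ʳ (litVars l)) ps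

module _ {a p q} {A : Set a} {P : Pred A p} {Q : Pred A q}
         (P? : Decidable P) (Q? : Decidable Q) where

  length-filter-< : P ⇒ Q → ∀ {x xs} → x ∈ xs → Q x → ¬ P x →
                    length (filter P? xs) < length (filter Q? xs)
  length-filter-< P⇒Q {x} {xs} x∈xs Qx ¬Px =
    ≤∧≢⇒< (length-mono-≤ P⊆Q) λ same-length →
      ¬Px (proj₂ (∈-filter⁻ P? {xs = xs} (subst (x ∈_) (sym (≋⇒≡ (to-≋ same-length P⊆Q)))
                                           (∈-filter⁺ Q? x∈xs Qx))))
    where
    P⊆Q : filter P? xs ⊆ filter Q? xs
    P⊆Q = filter⁺ P? Q? {as = xs} (λ { refl → P⇒Q }) ⊆-refl

∈-singVarsˡ : ∀ {x y} ψ → (x , y) ∈ ψ → x ∈ singVars ψ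
∈-singVarsˡ (_ ∷ _) (here refl) = here refl
∈-singVarsˡ (_ ∷ ψ) (there xy∈ψ) = there (there (∈-singVarsˡ ψ xy∈ψ))

∈-singVarsʳ : ∀ {x y} ψ → (x , y) ∈ ψ → y ∈ singVars ψ
∈-singVarsʳ (_ ∷ _) (here refl) = there (here refl)
∈-singVarsʳ (_ ∷ ψ) (there xy∈ψ) = there (there (∈-singVarsʳ ψ xy∈ψ))

module Construction (em : ExcludedMiddle (lsuc 0ℓ)) (φ : BSTConj) (ψ : SingConj)
                    (M M̃ : Assignment) (ξ : SatXi φ ψ M M̃) where

  S : ℕ
  S = length ψ

  X Y : Fin S → Var
  X i = proj₁ (lookup ψ i)
  Y i = proj₂ (lookup ψ i)

  L : List Var
  L = Vars φ ψ

  N : ℕ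
  N = length L

  X∈L : ∀ i → X i ∈ L
  X∈L i = ∈-++⁺ʳ (bstVars φ) (∈-singVarsˡ ψ (∈-lookup i))

  Y∈L : ∀ i → Y i ∈ L
  Y∈L i = ∈-++⁺ʳ (bstVars φ) (∈-singVarsʳ ψ (∈-lookup i))

  X⊈Y : ∀ i → ¬ (M (X i) ⊆ᵥ M (Y i))
  X⊈Y i = proj₁ ξ (∈-lookup i)

  Y≐⇔X≐ : ∀ i j → (M (Y i) ≐ M (Y j)) ⇔ (M (X i) ≐ M (X j))
  Y≐⇔X≐ i j = proj₁ (proj₂ ξ) (∈-lookup i) (∈-lookup j)

  meets⇒X⊆ : ∀ i {t} → t ∈ L → InterNonEmpty (M (X i)) (M t) → M (X i) ⊆ᵥ M t
  meets⇒X⊆ i = proj₁ (proj₂ (proj₂ ξ)) (∈-lookup i)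

  meets⇒Ỹ⊊ : ∀ i {t} → t ∈ L → InterNonEmpty (M (X i)) (M t) → M̃ (Y i) ⊊ᵥ M̃ t
  meets⇒Ỹ⊊ i = proj₁ (proj₂ (proj₂ (proj₂ ξ))) (∈-lookup i)

  X-inhabited : ∀ i → Σ V λ z → z ∈ᵥ M (X i)
  X-inhabited i with em {Σ V λ z → z ∈ᵥ M (X i)}
  ... | yes inhabited = inhabited
  ... | no  empty     = ⊥-elim (X⊈Y i λ z z∈X → ⊥-elim (empty (z , z∈X)))

  meets⇒Y≐ : ∀ i j → InterNonEmpty (M (X i)) (M (X j)) → M (Y i) ≐ M (Y j)
  meets⇒Y≐ i j (z , z∈Xi , z∈Xj) = from (Y≐⇔X≐ i j)
    (⊆ᵥ-antisym (meets⇒X⊆ i (X∈L j) (z , z∈Xi , z∈Xj)) (meets⇒X⊆ j (X∈L i) (z , z∈Xj , z∈Xi)))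

  rank : Var → ℕ
  rank v = length (filter (λ w → em {M̃ w ⊊ᵥ M̃ v}) L)

  rank≤N : ∀ v → rank v ≤ N
  rank≤N v = length-filter (λ w → em {M̃ w ⊊ᵥ M̃ v}) L

  meets⇒rank< : ∀ i {t} → t ∈ L → InterNonEmpty (M (X i)) (M t) → rank (Y i) < rank t
  meets⇒rank< i {t} tL meets =
    length-filter-< (λ w → em) (λ w → em) (λ w⊊Y → ⊊ᵥ-trans w⊊Y Ỹ⊊t) (Y∈L i) Ỹ⊊t ⊊ᵥ-irrefl
    where
    Ỹ⊊t : M̃ (Y i) ⊊ᵥ M̃ t
    Ỹ⊊t = meets⇒Ỹ⊊ i tL meets

  rank-Y<N : ∀ i → rank (Y i) < N
  rank-Y<N i with X-inhabited i
  ... | z , z∈X = <-≤-trans (meets⇒rank< i (X∈L i) (z , z∈X , z∈X)) (rank≤N (X i))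

  Covered : V → Set
  Covered z = Σ (Fin S) λ i → z ∈ᵥ M (X i)

  covered? : ∀ z → Dec (Covered z)
  covered? z = map′ lower lift em

  Covered-resp-≐ : ∀ {z z′} → z ≐ z′ → Covered z → Covered z′
  Covered-resp-≐ z≐z′ (i , z∈X) = i , ∈ᵥ-resp-≐ z≐z′ z∈X

  stage : ℕ → Var → V
  stage zero    t = ∅ᵥ
  stage (suc n) t =
    sup ((Σ (index (M t)) λ a → ¬ Covered (member (M t) a)) ⊎
         (Σ (Fin S) λ i → Σ (index (M (X i))) λ a → member (M (X i)) a ∈ᵥ M t))
        [ (λ old → tag S (member (M t) (proj₁ old))) , (λ new → stage n (Y (proj₁ new))) ]

  Represents : ℕ → V → V → Set
  Represents n z e = (¬ Covered z × e ≐ tag S z) ⊎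
                     (Σ (Fin S) λ i → z ∈ᵥ M (X i) × e ≐ stage n (Y i))

  representative : ∀ n z → Σ V (Represents n z)
  representative n z with covered? z
  ... | yes (i , z∈X) = stage n (Y i) , inj₂ (i , z∈X , ≐-refl)
  ... | no  uncovered = tag S z , inj₁ (uncovered , ≐-refl)

  ∈-stage⁺ : ∀ n {t z e} → z ∈ᵥ M t → Represents n z e → e ∈ᵥ stage (suc n) t
  ∈-stage⁺ n z∈t (inj₁ (uncovered , e≐tag)) =
    let a , z≐a = ∈ᵥ⇒member z∈t in
    inj₁ (a , uncovered ∘ Covered-resp-≐ (≐-sym z≐a)) , ≐-trans e≐tag (tag-cong z≐a)
  ∈-stage⁺ n z∈t (inj₂ (i , z∈X , e≐stage)) =
    let a , z≐a = ∈ᵥ⇒member z∈X in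
    inj₂ (i , a , ∈ᵥ-resp-≐ z≐a z∈t) , e≐stage

  ∈-stage⁻ : ∀ n {t e} → e ∈ᵥ stage (suc n) t → Σ V λ z → z ∈ᵥ M t × Represents n z e
  ∈-stage⁻ n {t} (inj₁ (a , uncovered) , e≐tag) =
    member (M t) a , member-∈ᵥ (M t) a , inj₁ (uncovered , e≐tag)
  ∈-stage⁻ n (inj₂ (i , a , a∈t) , e≐stage) =
    member (M (X i)) a , a∈t , inj₂ (i , member-∈ᵥ (M (X i)) a , e≐stage)

  tag≉stage : ∀ n {t z} → ¬ (tag S z ≐ stage n t)
  tag≉stage n = tag≉narrow (stage (pred n) ∘ Y) (narrow n)
    where
    narrow : ∀ n {t e} → e ∈ᵥ stage n t →
             (Σ V λ z → e ≐ tag S z) ⊎ (Σ (Fin S) λ i → e ≐ stage (pred n) (Y i))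
    narrow zero    (() , _)
    narrow (suc n) e∈ with ∈-stage⁻ n e∈
    ... | z , _ , inj₁ (_ , e≐tag)       = inj₁ (z , e≐tag)
    ... | _ , _ , inj₂ (i , _ , e≐stage) = inj₂ (i , e≐stage)

  tag-∈-stage⁻ : ∀ n {t z} → tag S z ∈ᵥ stage (suc n) t → z ∈ᵥ M t
  tag-∈-stage⁻ n tag∈ with ∈-stage⁻ n tag∈
  ... | _ , z′∈t , inj₁ (_ , tag≐tag) = ∈ᵥ-resp-≐ (≐-sym (tag-injective tag≐tag)) z′∈t
  ... | _ , _ , inj₂ (_ , _ , tag≐stage) = ⊥-elim (tag≉stage n tag≐stage)

  stage-cong : ∀ n {a b} → M a ≐ M b → stage n a ≐ stage n b
  stage-cong zero    _   = ≐-refl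
  stage-cong (suc n) a≐b = ⊆ᵥ-antisym (included a≐b) (included (≐-sym a≐b))
    where
    included : ∀ {a b} → M a ≐ M b → stage (suc n) a ⊆ᵥ stage (suc n) b
    included a≐b e e∈ with ∈-stage⁻ n e∈
    ... | z , z∈a , r = ∈-stage⁺ n (≐⇒⊆ᵥ a≐b z z∈a) r

  stage-stable : ∀ n m {t} → t ∈ L → rank t < n → rank t < m → stage n t ≐ stage m t
  stage-stable (suc n) (suc m) {t} tL t<n t<m = sup-cong λ
    { (inj₁ _)             → ≐-refl
    ; (inj₂ (i , a , a∈t)) →
        let Y<t = meets⇒rank< i tL (member (M (X i)) a , member-∈ᵥ (M (X i)) a , a∈t) in
        stage-stable n m (Y∈L i) (<-≤-trans Y<t (s≤s⁻¹ t<n)) (<-≤-trans Y<t (s≤s⁻¹ t<m)) }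

  mutual
    stage-injective : ∀ n {a b} → a ∈ L → b ∈ L → rank a < n → rank b < n →
                      stage n a ≐ stage n b → M a ≐ M b
    stage-injective (suc n) aL bL a<n b<n a≐b =
      ⊆ᵥ-antisym (included aL bL a<n b<n a≐b) (included bL aL b<n a<n (≐-sym a≐b))
      where
      included : ∀ {a b} → a ∈ L → b ∈ L → rank a < suc n → rank b < suc n →
                 stage (suc n) a ≐ stage (suc n) b → M a ⊆ᵥ M b
      included aL bL a<n b<n a≐b z z∈a with representative n z
      ... | e , r = ∈-stage-reflects n bL (s≤s⁻¹ b<n) Y<n r (≐⇒⊆ᵥ a≐b e (∈-stage⁺ n z∈a r))
        where
        Y<n : ∀ {i} → z ∈ᵥ M (X i) → rank (Y i) < n
        Y<n z∈X = <-≤-trans (meets⇒rank< _ aL (z , z∈X , z∈a)) (s≤s⁻¹ a<n)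

    ∈-stage-reflects : ∀ n {t z e} → t ∈ L → rank t ≤ n →
                       (∀ {i} → z ∈ᵥ M (X i) → rank (Y i) < n) →
                       Represents n z e → e ∈ᵥ stage (suc n) t → z ∈ᵥ M t
    ∈-stage-reflects n _ _ _ (inj₁ (_ , e≐tag)) e∈ = tag-∈-stage⁻ n (∈ᵥ-resp-≐ e≐tag e∈)
    ∈-stage-reflects n tL t≤n Y<n (inj₂ (i , z∈Xi , e≐stage)) e∈
      with ∈-stage⁻ n (∈ᵥ-resp-≐ e≐stage e∈)
    ... | _ , _ , inj₁ (_ , stage≐tag) = ⊥-elim (tag≉stage n (≐-sym stage≐tag))
    ... | z′ , z′∈t , inj₂ (j , z′∈Xj , stage≐stage) =
      meets⇒X⊆ j tL (z′ , z′∈Xj , z′∈t) _ (≐⇒⊆ᵥ (to (Y≐⇔X≐ i j) MYi≐MYj) _ z∈Xi)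
      where
      MYi≐MYj : M (Y i) ≐ M (Y j)
      MYi≐MYj = stage-injective n (Y∈L i) (Y∈L j) (Y<n z∈Xi)
                  (<-≤-trans (meets⇒rank< j tL (z′ , z′∈Xj , z′∈t)) t≤n) stage≐stage

  M′ : Assignment
  M′ = stage (suc N)

  tracks : ∀ {t} → t ∈ L → Tracks (Represents N) (M t) (M′ t)
  tracks tL = record
    { ∈-preserved = λ r → mk⇔ (λ z∈t → ∈-stage⁺ N z∈t r)
                              (∈-stage-reflects N tL (rank≤N _) (λ {i} _ → rank-Y<N i) r)
    ; ∈-covered   = λ e∈ → let z , _ , r = ∈-stage⁻ N e∈ in z , r
    }

  M′-singleton : ∀ i → IsSingleton (M′ (X i)) (M′ (Y i))
  M′-singleton i e = mk⇔ member⇒≐ ≐⇒member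
    where
    stable : stage N (Y i) ≐ M′ (Y i)
    stable = stage-stable N (suc N) (Y∈L i) (rank-Y<N i) (m<n⇒m<1+n (rank-Y<N i))

    member⇒≐ : e ∈ᵥ M′ (X i) → e ≐ M′ (Y i)
    member⇒≐ e∈ with ∈-stage⁻ N e∈
    ... | z , z∈Xi , inj₁ (uncovered , _) = ⊥-elim (uncovered (i , z∈Xi))
    ... | z , z∈Xi , inj₂ (j , z∈Xj , e≐stage) =
      ≐-trans e≐stage (≐-trans (stage-cong N (meets⇒Y≐ j i (z , z∈Xj , z∈Xi))) stable)

    ≐⇒member : e ≐ M′ (Y i) → e ∈ᵥ M′ (X i)
    ≐⇒member e≐ with X-inhabited i
    ... | z , z∈Xi = ∈ᵥ-resp-≐ (≐-trans stable (≐-sym e≐))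
                                (∈-stage⁺ N z∈Xi (inj₂ (i , z∈Xi , ≐-refl)))

  M′-SatSing : SatSing M′ ψ
  M′-SatSing = subst (All _) (tabulate-lookup ψ) (tabulate⁺ M′-singleton)

  M′-SatBST : SatBST M φ → SatBST M′ φ
  M′-SatBST = SatBST-preserved (Represents N) (representative N) φ (tracks ∘ ∈-++⁺ˡ)

lemma9 : ExcludedMiddle (lsuc 0ℓ) →
         (φ : BSTConj) (ψ : SingConj) →
         SatisfiableWithXi φ ψ → Satisfiable φ ψ
lemma9 em φ ψ (M , M̃ , M⊨φ , M⊨Ξ) = M′ , M′-SatBST M⊨φ , M′-SatSing
  where open Construction em φ ψ M M̃ M⊨Ξ
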